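{- Let $m,n$ be positive integers with $m\ge 5$, $n\ge 4$ and $m-1\mid (n-3)$, and let $i\in\{1,2\}$. Then $r(T_m^i,T_n')=m+n-3$.
   Context: All graphs are finite and simple. For graphs $G_1,G_2$, the Ramsey number $r(G_1,G_2)$ is the smallest positive integer $N$ such that for every graph $G$ on $N$ vertices, either $G$ contains a subgraph isomorphic to $G_1$ or the complement $\overline G$ contains a subgraph isomorphic to $G_2$. $T_m^1$ is the tree with vertex set $\{v_0,\ldots,v_{m-1}\}$ and edge set $\{v_0v_1,\ldots,v_0v_{m-3},v_{m-4}v_{m-2},v_{m-3}v_{m-1}\}$; $T_m^2$ is the tree with the same vertex set and edge set $\{v_0v_1,\ldots,v_0v_{m-3},v_{m-3}v_{m-2},v_{m-3}v_{m-1}\}$. $T_n'$ is the unique (up to isomorphism) tree on $n$ vertices with maximum degree $n-2$ (defined for $n\ge 4$). -}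

module Defs where

open import Data.Nat using (ℕ; zero; suc; _+_; _∸_; _≤_; _<_; _≡ᵇ_; _≤ᵇ_)
open import Data.Bool using (Bool; true; false; _∧_; _∨_; not)
open import Data.Bool.Properties using (∨-comm)
open import Data.Fin using (Fin; toℕ; _≟_)
open import Data.Product using (Σ; _×_; _,_)
open import Data.Sum using (_⊎_)
open import Relation.Nullary using (¬_; yes; no)
open import Relation.Nullary.Decidable using (⌊_⌋)
open import Relation.Binary.PropositionalEquality using (_≡_; refl; cong₂; sym)
open import Function.Definitions using (Injective)

record SimpleGraph (n : ℕ) : Set where
  field
    adj    : Fin n → Fin n → Bool
    adj-sym : ∀ i j → adj i j ≡ adj j i
    adj-irrefl : ∀ i → adj i i ≡ false
open SimpleGraph public

neq : ∀ {n} → Fin n → Fin n → Bool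
neq i j = not ⌊ i ≟ j ⌋

neq-sym : ∀ {n} (i j : Fin n) → neq i j ≡ neq j i
neq-sym i j with i ≟ j | j ≟ i
... | yes _ | yes _ = refl
... | no _  | no _  = refl
... | yes p | no q  with q (sym p)
...   | ()
neq-sym i j | no p | yes q with p (sym q)
...   | ()

neq-irrefl : ∀ {n} (i : Fin n) → neq i i ≡ false
neq-irrefl i with i ≟ i
... | yes _ = refl
... | no p with p refl
...   | ()

fromRel : ∀ {n} → (Fin n → Fin n → Bool) → SimpleGraph n
fromRel {n} R = record
  { adj = λ i j → neq i j ∧ (R i j ∨ R j i)
  ; adj-sym = λ i j → cong₂ _∧_ (neq-sym i j) (∨-comm (R i j) (R j i))
  ; adj-irrefl = λ i → cong₂ _∧_ (neq-irrefl i) refl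
  }

complement : ∀ {n} → SimpleGraph n → SimpleGraph n
complement G = fromRel (λ i j → not (adj G i j))

_⊆G_ : ∀ {h n} → SimpleGraph h → SimpleGraph n → Set
_⊆G_ {h} {n} H G =
  Σ (Fin h → Fin n) λ f →
    Injective _≡_ _≡_ f ×
    (∀ i j → adj H i j ≡ true → adj G (f i) (f j) ≡ true)

Arrows : ∀ {a b} → ℕ → SimpleGraph a → SimpleGraph b → Set
Arrows N G1 G2 = (G : SimpleGraph N) → (G1 ⊆G G) ⊎ (G2 ⊆G complement G)

RamseyNumberIs : ∀ {a b} → SimpleGraph a → SimpleGraph b → ℕ → Set
RamseyNumberIs G1 G2 N =
  1 ≤ N × Arrows N G1 G2 × (∀ M → 1 ≤ M → M < N → ¬ Arrows M G1 G2)

_==_ : ℕ → ℕ → Bool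
a == b = a ≡ᵇ b
infix 7 _==_

T1rel : ℕ → ℕ → ℕ → Bool
T1rel m a b = (a == 0 ∧ ((1 ≤ᵇ b) ∧ (b ≤ᵇ (m ∸ 3))))
            ∨ (a == (m ∸ 4) ∧ b == (m ∸ 2))
            ∨ (a == (m ∸ 3) ∧ b == (m ∸ 1))

T1 : (m : ℕ) → SimpleGraph m
T1 m = fromRel (λ i j → T1rel m (toℕ i) (toℕ j))

T2rel : ℕ → ℕ → ℕ → Bool
T2rel m a b = (a == 0 ∧ ((1 ≤ᵇ b) ∧ (b ≤ᵇ (m ∸ 3))))
            ∨ (a == (m ∸ 3) ∧ b == (m ∸ 2))
            ∨ (a == (m ∸ 3) ∧ b == (m ∸ 1))

T2 : (m : ℕ) → SimpleGraph m
T2 m = fromRel (λ i j → T2rel m (toℕ i) (toℕ j))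

-- T'_n : tree on n vertices with max degree n-2 (a representative):
-- edges u0u1,…,u0u_{n-2}, u_{n-2}u_{n-1}
T'rel : ℕ → ℕ → ℕ → Bool
T'rel n a b = (a == 0 ∧ ((1 ≤ᵇ b) ∧ (b ≤ᵇ (n ∸ 2))))
            ∨ (a == (n ∸ 2) ∧ b == (n ∸ 1))

T' : (n : ℕ) → SimpleGraph n
T' n = fromRel (λ i j → T'rel n (toℕ i) (toℕ j))

module Submission where

-- Let G have m + n - 3 vertices and H be its
-- complement.  If every vertex has degree ≥ m - 1, both trees embed greedily
-- (MinimumDegree).  Otherwise take v of degree ≤ m - 2, with non-neighbours
-- A (|A| ≥ n - 2) and neighbours B (LowDegree): an H-edge from A to B, or
-- inside A when |B| ≤ 2, completes the H-star at v to T'_n; without such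
-- edges G contains a K_{3,m-3}, which contains both trees (K3-trees).
-- Lower bound.  n - 3 = (1 + p)(m - 1), and m + n - 4 vertices carry 2 + p
-- disjoint cliques of size m - 1 (Blocks): the trees T_m^i, of radius 2, do
-- not fit in a clique, and in the complement the centre of T'_n would need
-- n - 2 neighbours outside its own clique, where only n - 3 vertices lie.

open import Defs
open import Data.Nat using (ℕ; zero; suc; _+_; _*_; _∸_; _≤_; _<_; z≤n; s≤s; _≤ᵇ_; _<?_; _≤?_)
open import Data.Nat.Tactic.RingSolver using (solve-∀)
open import Data.Nat.Properties
  using (≤-trans; ≤-reflexive; ≤-pred; +-suc; +-comm; +-identityʳ; m≤n⇒m⊓n≡m; ≡ᵇ⇒≡; ≡⇒≡ᵇ; ≤ᵇ⇒≤; ≤⇒≤ᵇ;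
         +-cancelʳ-<; m∸n+n≡m; ≮⇒≥; suc-injective; +-monoˡ-≤; +-monoʳ-≤; +-cancelˡ-≤; m≤n+m; ≰⇒>;
         <-irrefl; m≤n⇒m<n∨m≡n; n≤1+n; ≤-refl; m≤m+n; module ≤-Reasoning)
open import Data.Bool using (Bool; true; T; _∧_; _∨_; not)
open import Data.Bool.Properties using (T-≡; T-∧; T-∨; ∨-idem; ∧-zeroʳ; ¬-not)
import Data.Bool as Bool
import Data.Fin as Fin
import Data.Fin.Properties as Fin
open import Data.Fin using (Fin; zero; suc; toℕ; _≟_; inject≤; inject₁; fromℕ<; remQuot; combine; punchOut)
open import Data.Fin.Properties
  using (inject≤-injective; toℕ-fromℕ<; toℕ-inject₁; inject₁-injective; toℕ-injective; toℕ<n; combine-remQuot; combine-injective; punchOut-injective; pigeonhole; <⇒≢)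
open import Data.List using (List; []; _∷_; _++_; length; filter; take; allFin)
open import Data.List.Properties using (filter-all; length-take; length-++; length-tabulate)
open import Data.List.Membership.Propositional using (_∈_; _∉_; find; lose)
open import Data.List.Membership.Propositional.Properties using (∈-filter⁻; ∈-++⁺ˡ; ∈-++⁺ʳ; ∈-allFin)
open import Data.List.Relation.Unary.Any using (here; there; any?)
open import Data.List.Relation.Unary.All as All using (All; []; _∷_)
import Data.List.Relation.Unary.All.Properties as All
open import Data.List.Relation.Unary.AllPairs using ([]; _∷_)
open import Data.List.Relation.Unary.Unique.Propositional using (Unique)
open import Data.List.Relation.Unary.Unique.Propositional.Properties as Unique using (filter⁺; take⁺; allFin⁺)
open import Data.List.Relation.Binary.Subset.Propositional using (_⊆_)
open import Data.List.Relation.Binary.Disjoint.Propositional using (Disjoint)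
open import Data.List.Relation.Binary.Sublist.Propositional.Properties using (take-⊆; Any-resp-⊆)
open import Data.List.Relation.Binary.Permutation.Propositional using (_↭_; ↭-prep; ↭-trans; ↭-sym; ↭⇒↭ₛ)
open import Data.List.Relation.Binary.Permutation.Propositional.Properties using (++-comm; shifts; shift)
import Data.List.Relation.Binary.Permutation.Setoid.Properties as PermutationProperties
open import Data.Nat.Divisibility using (_∣_; divides)
open import Data.Product using (Σ-syntax; _×_; _,_; proj₁; proj₂)
open import Data.Sum as Sum using (_⊎_; inj₁; inj₂)
open import Function using (_∘_)
open import Function.Bundles using (_⇔_; mk⇔; Equivalence)
open import Function.Definitions using (Injective)
open import Level using (0ℓ)
open import Relation.Nullary using (¬_; yes; no; ¬?; contradiction)
open import Relation.Nullary.Decidable using (⌊_⌋; toWitness; fromWitness)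
open import Relation.Unary using (Pred; Decidable)
open import Relation.Unary.Properties using (∁?)
open import Relation.Binary.Definitions using (DecidableEquality)
open import Relation.Binary.PropositionalEquality using (_≡_; _≢_; refl; sym; trans; cong; cong₂; subst; subst₂; setoid; module ≡-Reasoning)

module _ {A : Set} {P : Pred A 0ℓ} (P? : Decidable P) where

  length-filter-∁ : ∀ xs → length (filter P? xs) + length (filter (∁? P?) xs) ≡ length xs
  length-filter-∁ [] = refl
  length-filter-∁ (x ∷ xs) with P? x
  ... | yes _ = cong suc (length-filter-∁ xs)
  ... | no _ = trans (+-suc _ _) (cong suc (length-filter-∁ xs))

Unique-++⇒≢ : ∀ {A : Set} (xs : List A) {ys x y} → Unique (xs ++ ys) → x ∈ xs → y ∈ ys → x ≢ y
Unique-++⇒≢ (x ∷ xs) (x∉ ∷ _) (here refl) y∈ = All.lookup x∉ (∈-++⁺ʳ xs y∈)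
Unique-++⇒≢ (_ ∷ xs) (_ ∷ u) (there x∈) y∈ = Unique-++⇒≢ xs u x∈ y∈

Unique-resp-↭ : ∀ {A : Set} {xs ys : List A} → xs ↭ ys → Unique xs → Unique ys
Unique-resp-↭ {A} p = PermutationProperties.Unique-resp-↭ (setoid A) (↭⇒↭ₛ p)

∈∉⇒≢ : ∀ {A : Set} {z a : A} {zs} → z ∈ zs → a ∉ zs → z ≢ a
∈∉⇒≢ z∈ a∉ refl = a∉ z∈

module _ {A : Set} (_≟_ : DecidableEquality A) where

  without : A → List A → List A
  without z = filter (λ w → ¬? (w ≟ z))

  length-without : ∀ z {ys} → Unique ys → length ys ≤ suc (length (without z ys))
  length-without z {[]} _ = z≤n
  length-without z {y ∷ ys} (y∉ys ∷ u) with y ≟ z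
  ... | yes refl = s≤s (≤-reflexive (sym (cong length (filter-all _ (All.map (λ y≢w w≡y → y≢w (sym w≡y)) y∉ys)))))
  ... | no _ = s≤s (length-without z u)

  room-without : ∀ {k m} z {ys} → Unique ys → k + suc m ≤ length ys → k + m ≤ length (without z ys)
  room-without {k} {m} z u room =
    ≤-pred (≤-trans (≤-trans (≤-reflexive (sym (+-suc k m))) room) (length-without z u))

  pick : ∀ k {ys} zs → Unique ys → k + length zs ≤ length ys →
         Σ[ cs ∈ List A ] Unique cs × length cs ≡ k × cs ⊆ ys × Disjoint cs zs
  pick k {ys} [] u room =
    take k ys , take⁺ k u ,
    trans (length-take k ys) (m≤n⇒m⊓n≡m (≤-trans (≤-reflexive (sym (+-identityʳ k))) room)) ,
    Any-resp-⊆ (take-⊆ k ys) , λ ()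
  pick k {ys} (z ∷ zs) u room
    with cs , ucs , |cs| , cs⊆ , cs∩zs ← pick k zs (filter⁺ _ u) (room-without z u room) =
    cs , ucs , |cs| , (λ c∈ → proj₁ (∈-filter⁻ (λ w → ¬? (w ≟ z)) {xs = ys} (cs⊆ c∈))) , avoid
    where
    avoid : Disjoint cs (z ∷ zs)
    avoid (c∈ , here refl) = proj₂ (∈-filter⁻ (λ w → ¬? (w ≟ z)) {xs = ys} (cs⊆ c∈)) refl
    avoid (c∈ , there c∈zs) = cs∩zs (c∈ , c∈zs)

  pick-one : ∀ {ys} zs → Unique ys → 1 + length zs ≤ length ys → Σ[ y ∈ A ] y ∈ ys × y ∉ zs
  pick-one zs u room with pick 1 zs u room
  ... | y ∷ [] , _ , _ , y∈ , y∉ = y , y∈ (here refl) , λ y∈zs → y∉ (here refl , y∈zs)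

  pick-two : ∀ {ys} zs → Unique ys → 2 + length zs ≤ length ys →
             Σ[ y ∈ A ] Σ[ y′ ∈ A ] y ≢ y′ × y ∈ ys × y′ ∈ ys × y ∉ zs × y′ ∉ zs
  pick-two zs u room with pick 2 zs u room
  ... | y ∷ y′ ∷ [] , (y≢y′ ∷ []) ∷ _ , _ , ys∋ , zs∌ =
    y , y′ , y≢y′ , ys∋ (here refl) , ys∋ (there (here refl)) ,
    (λ y∈ → zs∌ (here refl , y∈)) , (λ y′∈ → zs∌ (there (here refl) , y′∈))

at : ∀ {A : Set} → A → List A → ℕ → A
at d [] _ = d
at d (x ∷ xs) zero = x
at d (x ∷ xs) (suc i) = at d xs i

module _ {A : Set} (d : A) where

  at-∈ : ∀ {xs i} → i < length xs → at d xs i ∈ xs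
  at-∈ {x ∷ xs} {zero} _ = here refl
  at-∈ {x ∷ xs} {suc i} (s≤s i<) = there (at-∈ i<)

  at-injective : ∀ {xs i j} → Unique xs → i < length xs → j < length xs → at d xs i ≡ at d xs j → i ≡ j
  at-injective {x ∷ xs} {zero} {zero} _ _ _ _ = refl
  at-injective {x ∷ xs} {zero} {suc j} (x∉ ∷ _) _ (s≤s j<) eq = contradiction eq (All.lookup x∉ (at-∈ j<))
  at-injective {x ∷ xs} {suc i} {zero} (x∉ ∷ _) (s≤s i<) _ eq = contradiction (sym eq) (All.lookup x∉ (at-∈ i<))
  at-injective {x ∷ xs} {suc i} {suc j} (_ ∷ u) (s≤s i<) (s≤s j<) eq = cong suc (at-injective u i< j< eq)

  at-++ˡ : ∀ {xs ys i} → i < length xs → at d (xs ++ ys) i ≡ at d xs i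
  at-++ˡ {x ∷ xs} {i = zero} _ = refl
  at-++ˡ {x ∷ xs} {i = suc i} (s≤s i<) = at-++ˡ {xs} i<

  at-++ʳ : ∀ xs {ys} j → at d (xs ++ ys) (j + length xs) ≡ at d ys j
  at-++ʳ xs {ys} j = trans (cong (at d (xs ++ ys)) (+-comm j (length xs))) (skip xs)
    where
    skip : ∀ xs → at d (xs ++ ys) (length xs + j) ≡ at d ys j
    skip [] = refl
    skip (x ∷ xs) = skip xs

open Equivalence using (to; from)

Adj : ∀ {n} → SimpleGraph n → Fin n → Fin n → Set
Adj G u w = adj G u w ≡ true

Adj? : ∀ {n} (G : SimpleGraph n) u → Decidable (Adj G u)
Adj? G u w = adj G u w Bool.≟ true

module _ {n} {G : SimpleGraph n} {u w : Fin n} where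

  Adj-sym : Adj G u w → Adj G w u
  Adj-sym = trans (adj-sym G w u)

  Adj⇒≢ : Adj G u w → u ≢ w
  Adj⇒≢ e refl = contradiction (trans (sym e) (adj-irrefl G u)) λ ()

neq-≢ : ∀ {n} {u w : Fin n} → u ≢ w → neq u w ≡ true
neq-≢ {u = u} {w} u≢w with u ≟ w
... | yes u≡w = contradiction u≡w u≢w
... | no _ = refl

module _ {n} (R : Fin n → Fin n → Bool) {i j : Fin n} where

  fromRel⁻ : Adj (fromRel R) i j → T (R i j) ⊎ T (R j i)
  fromRel⁻ e = T-∨ .to (proj₂ (T-∧ .to (T-≡ .from e)))

  fromRel⁺ : i ≢ j → T (R i j) → Adj (fromRel R) i j
  fromRel⁺ i≢j r = T-≡ .to (T-∧ .from (T-≡ .from (neq-≢ i≢j) , T-∨ .from (inj₁ r)))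

module _ {n} (G : SimpleGraph n) (u w : Fin n) where

  complement-adj : adj (complement G) u w ≡ neq u w ∧ not (adj G u w)
  complement-adj = trans (cong (λ b → neq u w ∧ (not (adj G u w) ∨ not b)) (adj-sym G w u))
                         (cong (neq u w ∧_) (∨-idem _))

  complement⁺ : u ≢ w → ¬ Adj G u w → Adj (complement G) u w
  complement⁺ u≢w ¬uw = trans complement-adj (cong₂ _∧_ (neq-≢ u≢w) (cong not (¬-not ¬uw)))

  complement⁻ : Adj (complement G) u w → ¬ Adj G u w
  complement⁻ e uw = contradiction
    (trans (sym e) (trans complement-adj (trans (cong (λ b → neq u w ∧ not b) uw) (∧-zeroʳ _))))
    λ ()

complement-dichotomy : ∀ {n} (G : SimpleGraph n) {u w} → u ≢ w → ¬ Adj (complement G) u w → Adj G u w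
complement-dichotomy G {u} {w} u≢w ¬uw with Adj? G u w
... | yes uw = uw
... | no ¬uw′ = contradiction (complement⁺ G u w u≢w ¬uw′) ¬uw

⊆G-transport : ∀ {h n n′} {H : SimpleGraph h} (G : SimpleGraph n) (G′ : SimpleGraph n′)
  (f : Fin n → Fin n′) → Injective _≡_ _≡_ f → (∀ {u w} → Adj G u w → Adj G′ (f u) (f w)) →
  H ⊆G G → H ⊆G G′
⊆G-transport G G′ f f-inj f-hom (g , g-inj , g-hom) =
  f ∘ g , g-inj ∘ f-inj , λ i j → f-hom ∘ g-hom i j

induced : ∀ {m n} → (Fin m → Fin n) → SimpleGraph n → SimpleGraph m
induced f G = record
  { adj = λ u w → adj G (f u) (f w)
  ; adj-sym = λ u w → adj-sym G (f u) (f w)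
  ; adj-irrefl = λ u → adj-irrefl G (f u)
  }

complement-induced : ∀ {m n} {f : Fin m → Fin n} (G : SimpleGraph n) → Injective _≡_ _≡_ f →
  ∀ {u w} → Adj (complement (induced f G)) u w → Adj (complement G) (f u) (f w)
complement-induced {f = f} G f-inj {u} {w} e =
  complement⁺ G (f u) (f w) (Adj⇒≢ {G = complement (induced f G)} e ∘ f-inj) (complement⁻ (induced f G) u w e)

-- The Ramsey property passes from M vertices to any larger number M′:
-- restrict a graph on M′ vertices to its first M vertices.
Arrows-mono : ∀ {a b M M′} {A : SimpleGraph a} {B : SimpleGraph b} →
  M ≤ M′ → Arrows M A B → Arrows M′ A B
Arrows-mono {M = M} {M′} {A} {B} M≤M′ arrows G =
  Sum.map (⊆G-transport {H = A} (induced ι G) G ι ι-inj (λ e → e))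
          (⊆G-transport {H = B} (complement (induced ι G)) (complement G) ι ι-inj (complement-induced G ι-inj))
          (arrows (induced ι G))
  where
  ι : Fin M → Fin M′
  ι i = inject≤ i M≤M′
  ι-inj : Injective _≡_ _≡_ ι
  ι-inj = inject≤-injective M≤M′ M≤M′ _ _

ramsey-number : ∀ {a b K K′} (A : SimpleGraph a) (B : SimpleGraph b) (Γ : SimpleGraph K′) → K ≤ K′ →
  ¬ A ⊆G Γ → ¬ B ⊆G complement Γ → Arrows (suc K) A B → RamseyNumberIs A B (suc K)
ramsey-number A B Γ K≤K′ no-A no-B arrows =
  s≤s z≤n , arrows ,
  λ M _ M≤K arrows-M → Sum.[ no-A , no-B ]′ (Arrows-mono {A = A} {B} (≤-trans (≤-pred M≤K) K≤K′) arrows-M Γ)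

Spoke : ℕ → ℕ → ℕ → Set
Spoke c a b = a ≡ 0 × 1 ≤ b × b ≤ c

spoke⇔ : ∀ {c a b} → T (a == 0 ∧ ((1 ≤ᵇ b) ∧ (b ≤ᵇ c))) ⇔ Spoke c a b
spoke⇔ {c} {a} {b} = mk⇔
  (λ t → let a0 , bc = T-∧ .to t ; 1b , b≤c = T-∧ .to bc in
         ≡ᵇ⇒≡ a 0 a0 , ≤ᵇ⇒≤ 1 b 1b , ≤ᵇ⇒≤ b c b≤c)
  (λ { (refl , 1≤b , b≤c) → T-∧ {x = true} .from (_ , T-∧ .from (≤⇒≤ᵇ 1≤b , ≤⇒≤ᵇ b≤c)) })

link⇔ : ∀ {p q a b} → T (a == p ∧ b == q) ⇔ (a ≡ p × b ≡ q)
link⇔ {p} {q} {a} {b} = mk⇔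
  (λ t → let ap , bq = T-∧ .to t in ≡ᵇ⇒≡ a p ap , ≡ᵇ⇒≡ b q bq)
  (λ { (refl , refl) → T-∧ .from (≡⇒≡ᵇ a a refl , ≡⇒≡ᵇ b b refl) })

Edge1 Edge2 Edge' : ℕ → ℕ → ℕ → Set
Edge1 m a b = Spoke (m ∸ 3) a b ⊎ (a ≡ m ∸ 4 × b ≡ m ∸ 2) ⊎ (a ≡ m ∸ 3 × b ≡ m ∸ 1)
Edge2 m a b = Spoke (m ∸ 3) a b ⊎ (a ≡ m ∸ 3 × b ≡ m ∸ 2) ⊎ (a ≡ m ∸ 3 × b ≡ m ∸ 1)
Edge' n a b = Spoke (n ∸ 2) a b ⊎ (a ≡ n ∸ 2 × b ≡ n ∸ 1)

∨-three⇔ : ∀ {s x y} {S X Y : Set} → T s ⇔ S → T x ⇔ X → T y ⇔ Y → T (s ∨ x ∨ y) ⇔ (S ⊎ X ⊎ Y)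
∨-three⇔ S X Y = mk⇔
  (Sum.map (S .to) (Sum.map (X .to) (Y .to) ∘ T-∨ .to) ∘ T-∨ .to)
  (T-∨ .from ∘ Sum.map (S .from) (T-∨ .from ∘ Sum.map (X .from) (Y .from)))

T1rel⇔ : ∀ {m a b} → T (T1rel m a b) ⇔ Edge1 m a b
T1rel⇔ = ∨-three⇔ spoke⇔ link⇔ link⇔

T2rel⇔ : ∀ {m a b} → T (T2rel m a b) ⇔ Edge2 m a b
T2rel⇔ = ∨-three⇔ spoke⇔ link⇔ link⇔

T'rel⇔ : ∀ {n a b} → T (T'rel n a b) ⇔ Edge' n a b
T'rel⇔ = mk⇔ (Sum.map (spoke⇔ .to) (link⇔ .to) ∘ T-∨ .to) (T-∨ .from ∘ Sum.map (spoke⇔ .from) (link⇔ .from))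

Labelled : ∀ h → (ℕ → ℕ → Bool) → SimpleGraph h
Labelled h R = fromRel (λ i j → R (toℕ i) (toℕ j))

labelling-copy : ∀ {h N} (G : SimpleGraph N) (R : ℕ → ℕ → Bool) (e : ℕ → Fin N) →
  (∀ {i j} → i < h → j < h → e i ≡ e j → i ≡ j) → (∀ {a b} → T (R a b) → Adj G (e a) (e b)) →
  Labelled h R ⊆G G
labelling-copy G R e e-inj e-hom =
  e ∘ toℕ ,
  (λ {i} {j} eq → toℕ-injective (e-inj (toℕ<n i) (toℕ<n j) eq)) ,
  λ i j ij → Sum.[ e-hom , Adj-sym {G = G} ∘ e-hom ]
                  (fromRel⁻ (λ i j → R (toℕ i) (toℕ j)) ij)

-- Labelling a tree by positions in this list puts label 0 on x, the labels
-- 1, …, |cs| on cs, and the labels |cs| + 1, |cs| + 2, … on ts.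
module Hub {N} (G : SimpleGraph N) (x : Fin N) (cs ts : List (Fin N))
           (distinct : Unique (x ∷ cs ++ ts)) (x~cs : ∀ {c} → c ∈ cs → Adj G x c) where

  e : ℕ → Fin N
  e = at x (x ∷ cs ++ ts)

  e-injective : ∀ {i j} → i < suc (length ts + length cs) → j < suc (length ts + length cs) →
                e i ≡ e j → i ≡ j
  e-injective i< j< = at-injective x distinct (fits i<) (fits j<)
    where
    fits : ∀ {i} → i < suc (length ts + length cs) → i < length (x ∷ cs ++ ts)
    fits {i} = subst (i <_) (cong suc (trans (+-comm (length ts) (length cs)) (sym (length-++ cs))))

  e-tail : ∀ j → e (suc (j + length cs)) ≡ at x ts j
  e-tail = at-++ʳ x cs

  e-spokes : ∀ r → (∀ {j} → j < r → Adj G x (at x ts j)) →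
             ∀ {t} → 1 ≤ t → t ≤ r + length cs → Adj G x (e t)
  e-spokes r x~ts {suc t} _ t< with t <? length cs
  ... | yes t<cs = subst (Adj G x) (sym (at-++ˡ x {cs} {ts} t<cs)) (x~cs (at-∈ x t<cs))
  ... | no t≮cs = subst (Adj G x) (trans (sym (e-tail j)) (cong (e ∘ suc) j+cs≡t)) (x~ts j<r)
    where
    j = t ∸ length cs
    j+cs≡t : j + length cs ≡ t
    j+cs≡t = m∸n+n≡m (≮⇒≥ t≮cs)
    j<r : j < r
    j<r = +-cancelʳ-< (length cs) j r (subst (_< r + length cs) (sym j+cs≡t) t<)

unique-hub : ∀ {N} {G : SimpleGraph N} {x cs ts} → (∀ {c} → c ∈ cs → Adj G x c) → All (x ≢_) ts →
  Unique cs → Unique ts → Disjoint cs ts → Unique (x ∷ cs ++ ts)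
unique-hub {G = G} x~cs x≢ts ucs uts cs∩ts =
  All.++⁺ (All.tabulate (Adj⇒≢ {G = G} ∘ x~cs)) x≢ts ∷ Unique.++⁺ ucs uts cs∩ts

module _ {N} (G : SimpleGraph N) where

  T1-copy : ∀ {k} x cs y₁ y₂ a b → length cs ≡ k → Unique (x ∷ cs ++ y₁ ∷ y₂ ∷ a ∷ b ∷ []) →
    (∀ {c} → c ∈ cs → Adj G x c) → Adj G x y₁ → Adj G x y₂ → Adj G y₁ a → Adj G y₂ b →
    T1 (5 + k) ⊆G G
  T1-copy x cs y₁ y₂ a b refl distinct x~cs x~y₁ x~y₂ y₁~a y₂~b =
    labelling-copy G (T1rel (5 + length cs)) e e-injective
      (λ {p} {q} r → edge (T1rel⇔ {5 + length cs} {p} {q} .to r))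
    where
    open Hub G x cs (y₁ ∷ y₂ ∷ a ∷ b ∷ []) distinct x~cs
    x~y₁y₂ : ∀ {j} → j < 2 → Adj G x (at x (y₁ ∷ y₂ ∷ a ∷ b ∷ []) j)
    x~y₁y₂ {0} _ = x~y₁
    x~y₁y₂ {1} _ = x~y₂
    x~y₁y₂ {suc (suc _)} (s≤s (s≤s ()))
    edge : ∀ {p q} → Edge1 (5 + length cs) p q → Adj G (e p) (e q)
    edge (inj₁ (refl , 1≤t , t≤)) = e-spokes 2 x~y₁y₂ 1≤t t≤
    edge (inj₂ (inj₁ (refl , refl))) = subst₂ (Adj G) (sym (e-tail 0)) (sym (e-tail 2)) y₁~a
    edge (inj₂ (inj₂ (refl , refl))) = subst₂ (Adj G) (sym (e-tail 1)) (sym (e-tail 3)) y₂~b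

  T2-copy : ∀ {k} x cs y a b → length cs ≡ k → Unique (x ∷ cs ++ y ∷ a ∷ b ∷ []) →
    (∀ {c} → c ∈ cs → Adj G x c) → Adj G x y → Adj G y a → Adj G y b → T2 (4 + k) ⊆G G
  T2-copy x cs y a b refl distinct x~cs x~y y~a y~b =
    labelling-copy G (T2rel (4 + length cs)) e e-injective
      (λ {p} {q} r → edge (T2rel⇔ {4 + length cs} {p} {q} .to r))
    where
    open Hub G x cs (y ∷ a ∷ b ∷ []) distinct x~cs
    x~y′ : ∀ {j} → j < 1 → Adj G x (at x (y ∷ a ∷ b ∷ []) j)
    x~y′ {0} _ = x~y
    x~y′ {suc _} (s≤s ())
    edge : ∀ {p q} → Edge2 (4 + length cs) p q → Adj G (e p) (e q)
    edge (inj₁ (refl , 1≤t , t≤)) = e-spokes 1 x~y′ 1≤t t≤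
    edge (inj₂ (inj₁ (refl , refl))) = subst₂ (Adj G) (sym (e-tail 0)) (sym (e-tail 1)) y~a
    edge (inj₂ (inj₂ (refl , refl))) = subst₂ (Adj G) (sym (e-tail 0)) (sym (e-tail 2)) y~b

  T'-copy : ∀ {l} v cs x y → length cs ≡ l → Unique (v ∷ cs ++ x ∷ y ∷ []) →
    (∀ {c} → c ∈ cs → Adj G v c) → Adj G v x → Adj G x y → T' (3 + l) ⊆G G
  T'-copy v cs x y refl distinct v~cs v~x x~y =
    labelling-copy G (T'rel (3 + length cs)) e e-injective
      (λ {p} {q} r → edge (T'rel⇔ {3 + length cs} {p} {q} .to r))
    where
    open Hub G v cs (x ∷ y ∷ []) distinct v~cs
    v~x′ : ∀ {j} → j < 1 → Adj G v (at v (x ∷ y ∷ []) j)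
    v~x′ {0} _ = v~x
    v~x′ {suc _} (s≤s ())
    edge : ∀ {p q} → Edge' (3 + length cs) p q → Adj G (e p) (e q)
    edge (inj₁ (refl , 1≤t , t≤)) = e-spokes 1 v~x′ 1≤t t≤
    edge (inj₂ (refl , refl)) = subst₂ (Adj G) (sym (e-tail 0)) (sym (e-tail 1)) x~y

  -- Three vertices b₀, b₁, b₂ joined to all of 2 + k further vertices (a copy
  -- of K_{3,2+k}) contain both T_{5+k}^1 and T_{5+k}^2: centre b₀, with the
  -- remaining b's as the two far leaves.
  K3-trees : ∀ k b₀ b₁ b₂ as → length as ≡ 2 + k → Unique (b₀ ∷ b₁ ∷ b₂ ∷ as) →
    (∀ {p q} → p ∈ b₀ ∷ b₁ ∷ b₂ ∷ [] → q ∈ as → Adj G p q) → T1 (5 + k) ⊆G G × T2 (5 + k) ⊆G G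
  K3-trees k b₀ b₁ b₂ (y₁ ∷ y₂ ∷ cs) |as| distinct cross =
    T1-copy b₀ cs y₁ y₂ b₁ b₂ |cs| (Unique-resp-↭ to-T1-order distinct)
      (cross b₀∈ ∘ there ∘ there) (cross b₀∈ (here refl)) (cross b₀∈ (there (here refl)))
      (Adj-sym {G = G} (cross b₁∈ (here refl))) (Adj-sym {G = G} (cross b₂∈ (there (here refl)))) ,
    T2-copy b₀ (y₂ ∷ cs) y₁ b₁ b₂ (suc-injective |as|) (Unique-resp-↭ to-T2-order distinct)
      (cross b₀∈ ∘ there) (cross b₀∈ (here refl))
      (Adj-sym {G = G} (cross b₁∈ (here refl))) (Adj-sym {G = G} (cross b₂∈ (here refl)))
    where
    b₀∈ = here refl
    b₁∈ = there (here refl)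
    b₂∈ = there (there (here refl))
    |cs| : length cs ≡ k
    |cs| = suc-injective (suc-injective |as|)
    bs = b₁ ∷ b₂ ∷ []
    to-T1-order : b₀ ∷ bs ++ y₁ ∷ y₂ ∷ cs ↭ b₀ ∷ cs ++ y₁ ∷ y₂ ∷ bs
    to-T1-order = ↭-prep b₀ (↭-trans (++-comm bs (y₁ ∷ y₂ ∷ cs)) (shifts (y₁ ∷ y₂ ∷ []) cs))
    to-T2-order : b₀ ∷ bs ++ y₁ ∷ y₂ ∷ cs ↭ b₀ ∷ (y₂ ∷ cs) ++ y₁ ∷ bs
    to-T2-order = ↭-prep b₀ (↭-trans (++-comm bs (y₁ ∷ y₂ ∷ cs)) (↭-sym (shift y₁ (y₂ ∷ cs) bs)))

module Neighbourhoods {N} (G : SimpleGraph N) where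

  others nbhd nonNbhd : Fin N → List (Fin N)
  others v = without _≟_ v (allFin N)
  nbhd v = filter (Adj? G v) (others v)
  nonNbhd v = filter (∁? (Adj? G v)) (others v)

  degree : Fin N → ℕ
  degree v = length (nbhd v)

  others-Unique : ∀ v → Unique (others v)
  others-Unique v = filter⁺ _ (allFin⁺ N)

  nbhd-Unique : ∀ v → Unique (nbhd v)
  nbhd-Unique v = filter⁺ _ (others-Unique v)

  nonNbhd-Unique : ∀ v → Unique (nonNbhd v)
  nonNbhd-Unique v = filter⁺ _ (others-Unique v)

  nbhd-Adj : ∀ {v w} → w ∈ nbhd v → Adj G v w
  nbhd-Adj {v} w∈ = proj₂ (∈-filter⁻ (Adj? G v) {xs = others v} w∈)

  nonNbhd-Adj : ∀ {v w} → w ∈ nonNbhd v → Adj (complement G) v w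
  nonNbhd-Adj {v} {w} w∈ = complement⁺ G v w (λ v≡w → w≢v (sym v≡w)) ¬vw
    where
    w∈others,¬vw = ∈-filter⁻ (∁? (Adj? G v)) {xs = others v} w∈
    ¬vw = proj₂ w∈others,¬vw
    w≢v = proj₂ (∈-filter⁻ (λ w → ¬? (w ≟ v)) {xs = allFin N} (proj₁ w∈others,¬vw))

  nbhd-≢ : ∀ {v w} → w ∈ nbhd v → v ≢ w
  nbhd-≢ = Adj⇒≢ {G = G} ∘ nbhd-Adj

  nbhd∩nonNbhd : ∀ v → Disjoint (nbhd v) (nonNbhd v)
  nbhd∩nonNbhd v (w∈ , w∈′) = complement⁻ G v _ (nonNbhd-Adj w∈′) (nbhd-Adj w∈)

  degree-count : ∀ v → N ≤ suc (degree v + length (nonNbhd v))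
  degree-count v = begin
    N                                          ≡⟨ sym (length-tabulate {n = N} (λ i → i)) ⟩
    length (allFin N)                          ≤⟨ length-without _≟_ v (allFin⁺ N) ⟩
    suc (length (others v))                    ≡⟨ cong suc (sym (length-filter-∁ (Adj? G v) (others v))) ⟩
    suc (degree v + length (nonNbhd v))        ∎
    where open ≤-Reasoning

-- If every vertex has degree at least m - 1 = 4 + k, then both trees T_m^1 and
-- T_m^2 can be embedded greedily from any vertex x.
module MinimumDegree {N} (G : SimpleGraph N) (k : ℕ) where
  open Neighbourhoods G

  module _ (minDegree : ∀ u → 4 + k ≤ degree u) (x : Fin N) where

    nbrs : ∀ j u zs → j + length zs ≤ 4 + k →
           Σ[ cs ∈ List (Fin N) ] Unique cs × length cs ≡ j × cs ⊆ nbhd u × Disjoint cs zs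
    nbrs j u zs room = pick _≟_ j zs (nbhd-Unique u) (≤-trans room (minDegree u))

    nbr : ∀ u zs → 1 + length zs ≤ 4 + k → Σ[ y ∈ Fin N ] y ∈ nbhd u × y ∉ zs
    nbr u zs room = pick-one _≟_ zs (nbhd-Unique u) (≤-trans room (minDegree u))

    two-nbrs : ∀ u zs → 2 + length zs ≤ 4 + k →
               Σ[ y ∈ Fin N ] Σ[ y′ ∈ Fin N ] y ≢ y′ × y ∈ nbhd u × y′ ∈ nbhd u × y ∉ zs × y′ ∉ zs
    two-nbrs u zs room = pick-two _≟_ zs (nbhd-Unique u) (≤-trans room (minDegree u))

    T1-greedy : T1 (5 + k) ⊆G G
    T1-greedy
      with y₁ , y₂ , y₁≢y₂ , y₁∈ , y₂∈ , _ ← two-nbrs x [] (s≤s (s≤s z≤n))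
      with a , a∈ , a∉ ← nbr y₁ (x ∷ y₂ ∷ []) (s≤s (s≤s (s≤s z≤n)))
      with b , b∈ , b∉ ← nbr y₂ (x ∷ y₁ ∷ a ∷ []) (s≤s (s≤s (s≤s (s≤s z≤n))))
      with cs , cs-Unique , |cs| , cs⊆ , cs∩ ← nbrs k x (y₁ ∷ y₂ ∷ a ∷ b ∷ []) (≤-reflexive (+-comm k 4)) =
      T1-copy G x cs y₁ y₂ a b |cs| distinct
        (nbhd-Adj ∘ cs⊆) (nbhd-Adj y₁∈) (nbhd-Adj y₂∈) (nbhd-Adj a∈) (nbhd-Adj b∈)
      where
      distinct : Unique (x ∷ cs ++ y₁ ∷ y₂ ∷ a ∷ b ∷ [])
      distinct = unique-hub {G = G} (nbhd-Adj ∘ cs⊆)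
        (nbhd-≢ y₁∈ ∷ nbhd-≢ y₂∈ ∷ ∈∉⇒≢ (here refl) a∉ ∷ ∈∉⇒≢ (here refl) b∉ ∷ [])
        cs-Unique
        ((y₁≢y₂ ∷ nbhd-≢ a∈ ∷ ∈∉⇒≢ (there (here refl)) b∉ ∷ [])
         ∷ (∈∉⇒≢ (there (here refl)) a∉ ∷ nbhd-≢ b∈ ∷ [])
         ∷ (∈∉⇒≢ (there (there (here refl))) b∉ ∷ [])
         ∷ [] ∷ [])
        cs∩

    T2-greedy : T2 (5 + k) ⊆G G
    T2-greedy
      with y , y∈ , _ ← nbr x [] (s≤s z≤n)
      with a , b , a≢b , a∈ , b∈ , a∉ , b∉ ← two-nbrs y (x ∷ []) (s≤s (s≤s (s≤s z≤n)))
      with cs , cs-Unique , |cs| , cs⊆ , cs∩ ← nbrs (1 + k) x (y ∷ a ∷ b ∷ []) (≤-reflexive (+-comm (1 + k) 3)) =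
      T2-copy G x cs y a b |cs| distinct (nbhd-Adj ∘ cs⊆) (nbhd-Adj y∈) (nbhd-Adj a∈) (nbhd-Adj b∈)
      where
      distinct : Unique (x ∷ cs ++ y ∷ a ∷ b ∷ [])
      distinct = unique-hub {G = G} (nbhd-Adj ∘ cs⊆)
        (nbhd-≢ y∈ ∷ ∈∉⇒≢ (here refl) a∉ ∷ ∈∉⇒≢ (here refl) b∉ ∷ [])
        cs-Unique
        ((nbhd-≢ a∈ ∷ nbhd-≢ b∈ ∷ []) ∷ (a≢b ∷ []) ∷ [] ∷ [])
        cs∩

search-edge : ∀ {n} (G : SimpleGraph n) (X Y : List (Fin n)) →
  (Σ[ x ∈ Fin n ] Σ[ y ∈ Fin n ] x ∈ X × y ∈ Y × Adj G x y) ⊎ (∀ {x y} → x ∈ X → y ∈ Y → ¬ Adj G x y)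
search-edge G X Y with any? (λ x → any? (Adj? G x) Y) X
... | yes found with x , x∈ , found′ ← find found with y , y∈ , xy ← find found′ = inj₁ (x , y , x∈ , y∈ , xy)
... | no none = inj₂ λ x∈ y∈ xy → none (lose x∈ (lose y∈ xy))

-- Let A be the non-neighbours and
-- B the neighbours of v, so |A| ≥ n - 2.  An H-edge from A to B, or, when
-- |B| ≤ 2, inside A, extends the H-star at v to T'_n; otherwise G contains
-- a K_{3,m-3} between B and A, or inside A.
module LowDegree {N} (G : SimpleGraph N) (k l : ℕ) (k≤l : k ≤ l) (2≤l : 2 ≤ l) (N-large : 6 + k + l ≤ N)
                 (v : Fin N) (v-low : Neighbourhoods.degree G v ≤ 3 + k) where
  open Neighbourhoods G

  H : SimpleGraph N
  H = complement G

  A B : List (Fin N)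
  A = nonNbhd v
  B = nbhd v

  A-Unique : Unique A
  A-Unique = nonNbhd-Unique v

  v~A : ∀ {c} → c ∈ A → Adj H v c
  v~A = nonNbhd-Adj

  A∩B : ∀ {c y} → c ∈ A → y ∈ B → c ≢ y
  A∩B c∈ y∈ refl = nbhd∩nonNbhd v (y∈ , c∈)

  A-count : ∀ {d} → degree v ≤ d → 6 + k + l ≤ suc (d + length A)
  A-count deg≤d = ≤-trans N-large (≤-trans (degree-count v) (s≤s (+-monoˡ-≤ (length A) deg≤d)))

  A-large : 2 + l ≤ length A
  A-large = +-cancelˡ-≤ (4 + k) (2 + l) (length A) (subst (_≤ 4 + k + length A) (sym (eq k l)) (A-count v-low))
    where
    eq : ∀ k l → 4 + k + (2 + l) ≡ 6 + k + l
    eq = solve-∀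

  A-larger : degree v ≤ 2 → 3 + k + l ≤ length A
  A-larger small = +-cancelˡ-≤ 3 (3 + k + l) (length A) (subst (_≤ 3 + length A) (sym (eq k l)) (A-count small))
    where
    eq : ∀ k l → 3 + (3 + k + l) ≡ 6 + k + l
    eq = solve-∀

  star-with-pendant : ∀ {x y} zs → x ∈ zs → (∀ {c} → c ∈ A → c ∉ zs → c ≢ y) →
    (1 + l) + length zs ≤ length A → x ∈ A → v ≢ y → Adj H x y → T' (4 + l) ⊆G H
  star-with-pendant {x} {y} zs x∈zs A∖zs≢y room x∈A v≢y xy
    with cs , cs-Unique , |cs| , cs⊆A , cs∩zs ← pick _≟_ (1 + l) zs A-Unique room =
    T'-copy H v cs x y |cs| distinct (v~A ∘ cs⊆A) (v~A x∈A) xy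
    where
    cs∩xy : Disjoint cs (x ∷ y ∷ [])
    cs∩xy (c∈ , here refl) = cs∩zs (c∈ , x∈zs)
    cs∩xy (c∈ , there (here refl)) = A∖zs≢y (cs⊆A c∈) (λ c∈zs → cs∩zs (c∈ , c∈zs)) refl
    distinct : Unique (v ∷ cs ++ x ∷ y ∷ [])
    distinct = unique-hub {G = H} (v~A ∘ cs⊆A) (Adj⇒≢ {G = H} (v~A x∈A) ∷ v≢y ∷ [])
      cs-Unique ((Adj⇒≢ {G = H} xy ∷ []) ∷ [] ∷ []) cs∩xy

  -- An H-edge from A to B: the H-star at v plus that edge is T'_{4+l}.
  AB-edge : ∀ {x y} → x ∈ A → y ∈ B → Adj H x y → T' (4 + l) ⊆G H
  AB-edge x∈A y∈B xy = star-with-pendant (_ ∷ []) (here refl) (λ c∈A _ → A∩B c∈A y∈B)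
    (subst (_≤ length A) (+-comm 1 (1 + l)) A-large) x∈A (nbhd-≢ y∈B) xy

  AA-edge : ∀ {x y} → 3 + k + l ≤ length A → x ∈ A → y ∈ A → Adj H x y → T' (4 + l) ⊆G H
  AA-edge A-big x∈A y∈A xy = star-with-pendant (_ ∷ _ ∷ []) (here refl) (λ _ c∉ c≡y → c∉ (there (here c≡y)))
    (≤-trans (≤-reflexive (+-comm (1 + l) 2)) (≤-trans (s≤s (s≤s (s≤s (m≤n+m l k)))) A-big))
    x∈A (Adj⇒≢ {G = H} (v~A y∈A)) xy

  -- No H-edges from A to B and |B| ≥ 3: three vertices of B and 2 + k of A
  -- span a K_{3,2+k} in G.
  AB-complete : (∀ {x y} → x ∈ A → y ∈ B → ¬ Adj H x y) → 3 ≤ degree v →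
    T1 (5 + k) ⊆G G × T2 (5 + k) ⊆G G
  AB-complete no-AB-edge B-large
    with pick _≟_ 3 [] (nbhd-Unique v) (subst (_≤ degree v) (sym (+-identityʳ 3)) B-large)
       | pick _≟_ (2 + k) [] A-Unique (≤-trans (≤-reflexive (+-identityʳ (2 + k))) (≤-trans (s≤s (s≤s k≤l)) A-large))
  ... | b₀ ∷ b₁ ∷ b₂ ∷ [] , bs-Unique , _ , bs⊆B , _ | as , as-Unique , |as| , as⊆A , _ =
    K3-trees G k b₀ b₁ b₂ as |as| (Unique.++⁺ bs-Unique as-Unique (λ (p∈bs , p∈as) → A∖B p∈as p∈bs refl)) cross
    where
    A∖B : ∀ {q p} → q ∈ as → p ∈ b₀ ∷ b₁ ∷ b₂ ∷ [] → q ≢ p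
    A∖B q∈ p∈ = A∩B (as⊆A q∈) (bs⊆B p∈)
    cross : ∀ {p q} → p ∈ b₀ ∷ b₁ ∷ b₂ ∷ [] → q ∈ as → Adj G p q
    cross p∈ q∈ = Adj-sym {G = G} (complement-dichotomy G (A∖B q∈ p∈) (no-AB-edge (as⊆A q∈) (bs⊆B p∈)))

  clique-room : 5 + k ≤ 3 + k + l
  clique-room = ≤-trans (≤-reflexive (cong (3 +_) (+-comm 2 k))) (+-monoʳ-≤ (3 + k) 2≤l)

  -- No H-edges inside A and |A| ≥ 5 + k: A contains a G-clique on 5 + k
  -- vertices, in particular a K_{3,2+k}.
  A-clique : (∀ {x y} → x ∈ A → y ∈ A → ¬ Adj H x y) → 3 + k + l ≤ length A →
    T1 (5 + k) ⊆G G × T2 (5 + k) ⊆G G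
  A-clique no-AA-edge A-big
    with pick _≟_ (5 + k) [] A-Unique (≤-trans (≤-reflexive (+-identityʳ (5 + k))) (≤-trans clique-room A-big))
  ... | b₀ ∷ b₁ ∷ b₂ ∷ as , distinct , |L| , L⊆A , _ =
    K3-trees G k b₀ b₁ b₂ as (suc-injective (suc-injective (suc-injective |L|))) distinct cross
    where
    cross : ∀ {p q} → p ∈ b₀ ∷ b₁ ∷ b₂ ∷ [] → q ∈ as → Adj G p q
    cross p∈ q∈ = complement-dichotomy G (Unique-++⇒≢ (b₀ ∷ b₁ ∷ b₂ ∷ []) distinct p∈ q∈)
      (no-AA-edge (L⊆A (∈-++⁺ˡ p∈)) (L⊆A (∈-++⁺ʳ (b₀ ∷ b₁ ∷ b₂ ∷ []) q∈)))

  dichotomy : (T1 (5 + k) ⊆G G × T2 (5 + k) ⊆G G) ⊎ T' (4 + l) ⊆G H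
  dichotomy with search-edge H A B
  ... | inj₁ (_ , _ , x∈A , y∈B , xy) = inj₂ (AB-edge x∈A y∈B xy)
  ... | inj₂ no-AB-edge with 3 ≤? degree v
  ...   | yes B-large = inj₁ (AB-complete no-AB-edge B-large)
  ...   | no B-small with A-larger (≤-pred (≰⇒> B-small)) | search-edge H A A
  ...     | A-big | inj₁ (_ , _ , x∈A , y∈A , xy) = inj₂ (AA-edge A-big x∈A y∈A xy)
  ...     | A-big | inj₂ no-AA-edge = inj₁ (A-clique no-AA-edge A-big)

-- For m = 5 + k, n = 4 + l with k ≤ l and 2 ≤ l, every graph G
-- on N ≥ m + n - 3 vertices contains T_m^1 and T_m^2, or its complement
-- contains T'_n: use a vertex of degree ≤ m - 2 if there is one, and the
-- greedy embedding otherwise.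
upper-bound : ∀ k l → k ≤ l → 2 ≤ l → ∀ {N} → 6 + k + l ≤ N → (G : SimpleGraph N) →
  (T1 (5 + k) ⊆G G × T2 (5 + k) ⊆G G) ⊎ T' (4 + l) ⊆G complement G
upper-bound k l k≤l 2≤l {N} N-large G with any? (λ v → Neighbourhoods.degree G v ≤? 3 + k) (allFin N)
... | yes low with v , _ , v-low ← find low = LowDegree.dichotomy G k l k≤l 2≤l N-large v v-low
... | no no-low = inj₁ (T1-greedy min-degree x₀ , T2-greedy min-degree x₀)
  where
  open Neighbourhoods G
  open MinimumDegree G k
  min-degree : ∀ u → 4 + k ≤ degree u
  min-degree u = ≰⇒> (no-low ∘ lose (∈-allFin u))
  x₀ : Fin N
  x₀ = fromℕ< (≤-trans (s≤s z≤n) N-large)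

-- The extremal graph: b disjoint cliques of d vertices each, on the vertex set
-- Fin (b * d) ≅ Fin b × Fin d.  A vertex u sits in block `block u` at
-- position `slot u`.
module Blocks (b d : ℕ) where

  block : Fin (b * d) → Fin b
  block u = proj₁ (remQuot {b} d u)

  slot : Fin (b * d) → Fin d
  slot u = proj₂ (remQuot {b} d u)

  same-block? : Fin (b * d) → Fin (b * d) → Bool
  same-block? u w = ⌊ block u ≟ block w ⌋

  Cliques : SimpleGraph (b * d)
  Cliques = fromRel same-block?

  block-slot-injective : ∀ {u w} → block u ≡ block w → slot u ≡ slot w → u ≡ w
  block-slot-injective {u} {w} bu≡bw su≡sw = begin
    u                              ≡⟨ combine-remQuot {b} d u ⟨
    combine (block u) (slot u)     ≡⟨ cong₂ combine bu≡bw su≡sw ⟩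
    combine (block w) (slot w)     ≡⟨ combine-remQuot {b} d w ⟩
    w                              ∎
    where open ≡-Reasoning

  Cliques-adj : ∀ {u w} → Adj Cliques u w → block u ≡ block w
  Cliques-adj {u} {w} e = Sum.[ toWitness , sym ∘ toWitness {a? = block w ≟ block u} ] (fromRel⁻ same-block? e)

  Cliques-nonadj : ∀ {u w} → Adj (complement Cliques) u w → block u ≢ block w
  Cliques-nonadj {u} {w} e bu≡bw =
    complement⁻ Cliques u w e (fromRel⁺ same-block? (Adj⇒≢ {G = complement Cliques} e) (fromWitness bu≡bw))

open Blocks using (Cliques)

Radius2 : ∀ {h} → SimpleGraph (suc h) → Set
Radius2 {h} T = ∀ i → i ≡ zero ⊎ Adj T zero i ⊎ Σ[ j ∈ Fin (suc h) ] Adj T zero j × Adj T j i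

-- A graph of radius ≤ 2 on more than d vertices has no copy in Cliques b d:
-- its vertices would all land in one block, and two of them in one slot.
no-copy-in-Cliques : ∀ {h b d} (T : SimpleGraph (suc h)) → Radius2 T → d < suc h → ¬ T ⊆G Cliques b d
no-copy-in-Cliques {b = b} {d} T radius d<h (f , f-inj , f-hom)
  with i , j , i<j , same-slot ← pigeonhole d<h (Blocks.slot b d ∘ f) =
  <⇒≢ i<j (f-inj (block-slot-injective (trans (same-block i) (sym (same-block j))) same-slot))
  where
  open Blocks b d
  same-block : ∀ i → block (f i) ≡ block (f zero)
  same-block i with radius i
  ... | inj₁ refl = refl
  ... | inj₂ (inj₁ 0i) = sym (Cliques-adj (f-hom zero i 0i))
  ... | inj₂ (inj₂ (j , 0j , ji)) = sym (trans (Cliques-adj (f-hom zero j 0j)) (Cliques-adj (f-hom j i ji)))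

-- A graph with a vertex c of degree s > b·d has no copy in the complement of
-- Cliques (1 + b) d: the s neighbours of c would lie outside c's block,
-- which leaves room for only b·d of them.
no-copy-in-complement : ∀ {h s b d} (T : SimpleGraph h) (c : Fin h) (leaf : Fin s → Fin h) →
  Injective _≡_ _≡_ leaf → (∀ i → Adj T c (leaf i)) → b * d < s → ¬ T ⊆G complement (Cliques (suc b) d)
no-copy-in-complement {s = s} {b} {d} T c leaf leaf-inj c~leaf bd<s (f , f-inj , f-hom) =
  collision (pigeonhole bd<s away)
  where
  open Blocks (suc b) d
  off : ∀ i → block (f c) ≢ block (f (leaf i))
  off i = Cliques-nonadj (f-hom c (leaf i) (c~leaf i))
  -- where the i-th leaf lands among the vertices outside the block of c
  away : Fin s → Fin (b * d)
  away i = combine (punchOut (off i)) (slot (f (leaf i)))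
  collision : ¬ (Σ[ i ∈ Fin s ] Σ[ j ∈ Fin s ] i Fin.< j × away i ≡ away j)
  collision (i , j , i<j , same)
    with combine-injective (punchOut (off i)) (slot (f (leaf i))) (punchOut (off j)) (slot (f (leaf j))) same
  ... | same-rest , same-slot =
    <⇒≢ i<j (leaf-inj (f-inj (block-slot-injective (punchOut-injective (off i) (off j) same-rest) same-slot)))

labelled-edge : ∀ {h} (R : ℕ → ℕ → Bool) → (∀ {a b} → T (R a b) → a < b) →
  ∀ {i j : Fin h} → T (R (toℕ i) (toℕ j)) → Adj (Labelled h R) i j
labelled-edge R upwards r = fromRel⁺ (λ i j → R (toℕ i) (toℕ j)) (λ { refl → <-irrefl refl (upwards r) }) r

NearZero : (ℕ → ℕ → Bool) → ℕ → ℕ → Set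
NearZero R h t = t ≡ 0 ⊎ T (R 0 t) ⊎ Σ[ s ∈ ℕ ] s < h × T (R 0 s) × T (R s t)

radius2-by-labels : ∀ {h} (R : ℕ → ℕ → Bool) → (∀ {a b} → T (R a b) → a < b) →
  (∀ {t} → t < suc h → NearZero R (suc h) t) →
  Radius2 (Labelled (suc h) R)
radius2-by-labels R upwards near i with near (toℕ<n i)
... | inj₁ t≡0 = inj₁ (toℕ-injective t≡0)
... | inj₂ (inj₁ r) = inj₂ (inj₁ (labelled-edge R upwards r))
... | inj₂ (inj₂ (s , s< , r₁ , r₂)) =
  inj₂ (inj₂ (fromℕ< s< , labelled-edge R upwards (subst (T ∘ R 0) (sym toℕj≡s) r₁)
                        , labelled-edge R upwards (subst (λ a → T (R a (toℕ i))) (sym toℕj≡s) r₂)))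
  where
  toℕj≡s = toℕ-fromℕ< s<

below-or-last-two : ∀ {t n} → t < 2 + n → t < n ⊎ t ≡ n ⊎ t ≡ suc n
below-or-last-two t< with m≤n⇒m<n∨m≡n (≤-pred t<)
... | inj₂ t≡1+n = inj₂ (inj₂ t≡1+n)
... | inj₁ t<1+n with m≤n⇒m<n∨m≡n (≤-pred t<1+n)
...   | inj₁ t<n = inj₁ t<n
...   | inj₂ t≡n = inj₂ (inj₁ t≡n)

-- T_m^1 and T_m^2 (m = 5 + k) have radius ≤ 2 around vertex 0: the leaves
-- m-2, m-1 hang off leaves of the central star.
T1-radius2 : ∀ k → Radius2 (T1 (5 + k))
T1-radius2 k = radius2-by-labels (T1rel (5 + k)) (λ {a} {b} r → upwards (T1rel⇔ {5 + k} {a} {b} .to r)) near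
  where
  upwards : ∀ {a b} → Edge1 (5 + k) a b → a < b
  upwards (inj₁ (refl , 1≤b , _)) = 1≤b
  upwards (inj₂ (inj₁ (refl , refl))) = s≤s (s≤s (n≤1+n k))
  upwards (inj₂ (inj₂ (refl , refl))) = s≤s (s≤s (s≤s (n≤1+n k)))
  edge : ∀ {a b} → Edge1 (5 + k) a b → T (T1rel (5 + k) a b)
  edge = T1rel⇔ {5 + k} .from
  near : ∀ {t} → t < 5 + k → NearZero (T1rel (5 + k)) (5 + k) t
  near {zero} _ = inj₁ refl
  near {suc t} (s≤s t<) with below-or-last-two {n = 2 + k} t<
  ... | inj₁ t<2+k = inj₂ (inj₁ (edge (inj₁ (refl , s≤s z≤n , t<2+k))))
  ... | inj₂ (inj₁ refl) = inj₂ (inj₂ (1 + k , s≤s (s≤s (m≤n+m k 3)) ,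
          edge (inj₁ (refl , s≤s z≤n , n≤1+n _)) , edge (inj₂ (inj₁ (refl , refl)))))
  ... | inj₂ (inj₂ refl) = inj₂ (inj₂ (2 + k , s≤s (s≤s (s≤s (m≤n+m k 2))) ,
          edge (inj₁ (refl , s≤s z≤n , ≤-refl)) , edge (inj₂ (inj₂ (refl , refl)))))

T2-radius2 : ∀ k → Radius2 (T2 (5 + k))
T2-radius2 k = radius2-by-labels (T2rel (5 + k)) (λ {a} {b} r → upwards (T2rel⇔ {5 + k} {a} {b} .to r)) near
  where
  upwards : ∀ {a b} → Edge2 (5 + k) a b → a < b
  upwards (inj₁ (refl , 1≤b , _)) = 1≤b
  upwards (inj₂ (inj₁ (refl , refl))) = ≤-refl
  upwards (inj₂ (inj₂ (refl , refl))) = s≤s (s≤s (s≤s (n≤1+n k)))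
  edge : ∀ {a b} → Edge2 (5 + k) a b → T (T2rel (5 + k) a b)
  edge = T2rel⇔ {5 + k} .from
  near : ∀ {t} → t < 5 + k → NearZero (T2rel (5 + k)) (5 + k) t
  near {zero} _ = inj₁ refl
  near {suc t} (s≤s t<) with below-or-last-two {n = 2 + k} t<
  ... | inj₁ t<2+k = inj₂ (inj₁ (edge (inj₁ (refl , s≤s z≤n , t<2+k))))
  ... | inj₂ (inj₁ refl) = inj₂ (inj₂ (2 + k , s≤s (s≤s (s≤s (m≤n+m k 2))) ,
          edge (inj₁ (refl , s≤s z≤n , ≤-refl)) , edge (inj₂ (inj₁ (refl , refl)))))
  ... | inj₂ (inj₂ refl) = inj₂ (inj₂ (2 + k , s≤s (s≤s (s≤s (m≤n+m k 2))) ,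
          edge (inj₁ (refl , s≤s z≤n , ≤-refl)) , edge (inj₂ (inj₂ (refl , refl)))))

T'-leaf : ∀ l → Fin (2 + l) → Fin (4 + l)
T'-leaf l i = suc (inject₁ i)

T'-star : ∀ l i → Adj (T' (4 + l)) zero (T'-leaf l i)
T'-star l i = fromRel⁺ (λ i j → T'rel (4 + l) (toℕ i) (toℕ j)) {zero} {T'-leaf l i} (λ ())
  (T'rel⇔ {4 + l} .from (inj₁ (refl , s≤s z≤n , subst (_< 2 + l) (sym (toℕ-inject₁ i)) (toℕ<n i))))

T'-leaf-injective : ∀ l → Injective _≡_ _≡_ (T'-leaf l)
T'-leaf-injective l = inject₁-injective ∘ Fin.suc-injective

-- Write m = 5 + k, n = 4 + l and n - 3 = (1 + p)(m - 1) (the quotient is not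
-- 0 as n - 3 > 0).  The upper bound applies since l ≥ m - 2.  The extremal
-- graph Γ is 2 + p cliques of size m - 1, on m + n - 4 vertices: the trees
-- T_m^i of radius 2 do not fit in a clique, and the centre of T'_n would need
-- n - 2 = 2 + l neighbours outside its own clique, which has only
-- (1 + p)(m - 1) = n - 3 vertices outside it.
theorem5p2 : (m n : ℕ) → 5 ≤ m → 4 ≤ n → (m ∸ 1) ∣ (n ∸ 3) →
    RamseyNumberIs (T1 m) (T' n) (m + n ∸ 3) × RamseyNumberIs (T2 m) (T' n) (m + n ∸ 3)
theorem5p2 (suc (suc (suc (suc (suc k))))) (suc (suc (suc (suc l))))
           (s≤s (s≤s (s≤s (s≤s (s≤s _))))) (s≤s (s≤s (s≤s (s≤s _)))) (divides zero ())
theorem5p2 (suc (suc (suc (suc (suc k))))) (suc (suc (suc (suc l))))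
           (s≤s (s≤s (s≤s (s≤s (s≤s _))))) (s≤s (s≤s (s≤s (s≤s _)))) (divides (suc p) n-3≡) =
  ramsey-number (T1 (5 + k)) (T' (4 + l)) Γ Γ-size no-T1 no-T' (Sum.map₁ proj₁ ∘ forced) ,
  ramsey-number (T2 (5 + k)) (T' (4 + l)) Γ Γ-size no-T2 no-T' (Sum.map₁ proj₂ ∘ forced)
  where
  3+k≤l : 3 + k ≤ l
  3+k≤l = ≤-pred (subst (4 + k ≤_) (sym n-3≡) (m≤m+n (4 + k) (p * (4 + k))))
  forced : (G : SimpleGraph (5 + k + (4 + l) ∸ 3)) →
           (T1 (5 + k) ⊆G G × T2 (5 + k) ⊆G G) ⊎ T' (4 + l) ⊆G complement G
  forced = upper-bound k l (≤-trans (m≤n+m k 3) 3+k≤l) (≤-trans (s≤s (s≤s z≤n)) 3+k≤l) (≤-reflexive (vertices k l))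
    where
    vertices : ∀ k l → 6 + k + l ≡ 2 + (k + (4 + l))
    vertices = solve-∀
  Γ : SimpleGraph ((2 + p) * (4 + k))
  Γ = Cliques (2 + p) (4 + k)
  Γ-size : 1 + (k + (4 + l)) ≤ (2 + p) * (4 + k)
  Γ-size = ≤-reflexive (trans (vertices k l) (cong (4 + k +_) n-3≡))
    where
    vertices : ∀ k l → 1 + (k + (4 + l)) ≡ 4 + k + (1 + l)
    vertices = solve-∀
  no-T1 : ¬ T1 (5 + k) ⊆G Γ
  no-T1 = no-copy-in-Cliques {b = 2 + p} (T1 (5 + k)) (T1-radius2 k) ≤-refl
  no-T2 : ¬ T2 (5 + k) ⊆G Γ
  no-T2 = no-copy-in-Cliques {b = 2 + p} (T2 (5 + k)) (T2-radius2 k) ≤-refl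
  no-T' : ¬ T' (4 + l) ⊆G complement Γ
  no-T' = no-copy-in-complement {b = 1 + p} (T' (4 + l)) zero (T'-leaf l) (T'-leaf-injective l) (T'-star l)
    (subst (_< 2 + l) n-3≡ ≤-refl)
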